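{- Let $n$ be a positive integer and let $q=p^k$ be a prime power with $p$ prime and $k\ge 2$. Then there are at least $p^k(p-1)^k/2^k-q$ intervals $L\subseteq[q-1]$ such that every $q$-modular $L$-differencing Sperner system $\mathcal{F}\subseteq 2^{[n]}$ satisfies $$|\mathcal{F}|\le\sum_{i=0}^{|L|}\binom{n-1}{i}.$$
   Context: $[n]=\{1,\ldots,n\}$, $[q-1]=\{1,\ldots,q-1\}$, $2^{[n]}$ is the family of all subsets of $[n]$; an interval is a set of consecutive integers. A family $\mathcal{F}\subseteq 2^{[n]}$ is $q$-modular $L$-differencing Sperner if for any distinct $A,B\in\mathcal{F}$ there is $\ell\in L$ with $|A\setminus B|\equiv\ell\pmod q$. -}

module Defs where

open import Data.Nat using (ℕ; zero; suc; _+_; _*_; _∸_; _≤_)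
open import Data.Nat.Combinatorics using (_C_)
open import Data.Product using (_×_; ∃; ∃₂; _,_)
open import Data.List using (List; length)
open import Data.List.Membership.Propositional using (_∈_)
open import Data.List.Relation.Unary.Unique.Propositional using (Unique)
open import Data.Fin.Subset using (Subset; _─_; ∣_∣)
open import Relation.Binary.PropositionalEquality using (_≡_)
open import Relation.Nullary using (¬_)

_≡_[mod_] : ℕ → ℕ → ℕ → Set
x ≡ y [mod q ] = ∃₂ λ i j → x + i * q ≡ y + j * q

sumTo : ℕ → (ℕ → ℕ) → ℕ
sumTo zero    f = f 0
sumTo (suc m) f = sumTo m f + f (suc m)

InInterval : ℕ → ℕ → ℕ → Set
InInterval a b ℓ = a ≤ ℓ × ℓ ≤ b

-- |L| for L = {a,...,b} with a ≤ b
intervalSize : ℕ → ℕ → ℕ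
intervalSize a b = suc (b ∸ a)

-- A family F ⊆ 2^[n], given as a duplicate-free list of subsets, is
-- q-modular L-differencing Sperner for L = {a..b}
DifferencingSperner : (n q a b : ℕ) → List (Subset n) → Set
DifferencingSperner n q a b F =
  ∀ {A B} → A ∈ F → B ∈ F → ¬ (A ≡ B) →
  ∃ λ ℓ → InInterval a b ℓ × (∣ A ─ B ∣ ≡ ℓ [mod q ])

GoodInterval : (n q a b : ℕ) → Set
GoodInterval n q a b =
  (F : List (Subset n)) → Unique F → DifferencingSperner n q a b F →
  length F ≤ sumTo (intervalSize a b) (λ i → (n ∸ 1) C i)

-- (a , b) encodes a nonempty interval {a..b} ⊆ [q-1]
ValidInterval : (q : ℕ) → ℕ × ℕ → Set
ValidInterval q (a , b) = 1 ≤ a × a ≤ b × b ≤ q ∸ 1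

module Submission where

-- Let q = p^k, L = {a, …, b} ⊆ [q − 1] and s = |L|.  Index vectors by the subsets T ⊆ {2, …, n}
-- with |T| ≤ s, and attach to a set A ∈ F the row T ↦ [T ∩ A = ∅] and the column
-- T ↦ [T ⊆ B]·C(q − a, s − |T|).  By a Vandermonde identity the row of A times the column of B
-- is C(|B ∖ A ∩ {2, …, n}| + q − a, s).  If p ∤ C(q − a, s), this is a unit mod p for A = B, while
-- for A ≠ B (listed so that sets avoiding 1 come first) |B ∖ A| ≡ ℓ ∈ L mod q puts its top
-- ≡ ℓ − a < s mod q, and then Lucas' theorem makes it divisible by p.  The matrix is thus
-- triangular mod p, so |F| is at most the number of coordinates, ∑_{i ≤ s} C(n − 1, i).
-- By Lucas' theorem again, p ∤ C(d, s) whenever the base-p digits of s and d satisfy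
-- 1 ≤ sᵢ ≤ dᵢ < p; there are (p(p − 1)/2)^k such pairs, and each gives the admissible interval
-- {q − d, …, q − d + s − 1}.

module TriangularSystems where

  open import Data.Nat as ℕ using (ℕ; zero; suc; z≤n; s≤s)
  open import Data.Nat.Primality using (Prime; euclidsLemma)
  import Data.Nat.Divisibility as ℕ
  open import Data.Integer as ℤ using (ℤ; +_; _+_; _*_; _-_)
  open import Data.Integer.Properties using (+-0-commutativeMonoid; abs-*; +-identityˡ; pos-+; pos-*)
  open import Data.Integer.Divisibility.Signed
    using (_∣_; divides; _∣?_; ∣ᵤ⇒∣; ∣⇒∣ᵤ; ∣m∣n⇒∣m+n; ∣m∣n⇒∣m-n; ∣n⇒∣m*n)
  open import Data.Integer.Tactic.RingSolver using (solve-∀)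
  open import Algebra.Properties.CommutativeMonoid.Sum +-0-commutativeMonoid using (sum; sum-remove)
  open import Data.Vec.Functional using (Vector; removeAt; head; tail)
  open import Data.Fin using (Fin; zero; suc)
  open import Data.Fin.Properties using (¬∀⟶∃¬)
  open import Data.List using (List; []; _∷_; length; lookup; map)
  open import Data.Nat.ListAction using () renaming (sum to sum′)
  open import Data.List.Relation.Unary.All as All using (All; []; _∷_)
  open import Data.List.Relation.Unary.AllPairs using (AllPairs; []; _∷_)
  open import Data.Product using (_,_; ∃; proj₁; proj₂)
  open import Data.Sum using (_⊎_; inj₁; inj₂; [_,_])
  open import Relation.Nullary using (¬_; contradiction)
  open import Relation.Binary.PropositionalEquality hiding ([_])
  open import Function using (_∘_)

  infix 7 _·_
  -- Opaque, so that the typechecker never unfolds these finite sums.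
  opaque
    _·_ : ∀ {N} → Vector ℤ N → Vector ℤ N → ℤ
    u · v = sum (λ c → u c * v c)

    ∣-· : ∀ {N} d (u v : Vector ℤ N) → (∀ c → d ∣ v c) → d ∣ u · v
    ∣-· {zero}  d u v _    = divides (+ 0) refl
    ∣-· {suc N} d u v d∣v = ∣m∣n⇒∣m+n (∣n⇒∣m*n (head u) (d∣v zero)) (∣-· d (tail u) (tail v) (d∣v ∘ suc))

    ·-removeAt : ∀ {N} (k : Fin (suc N)) (u v : Vector ℤ (suc N)) → u · v ≡ u k * v k + removeAt u k · removeAt v k
    ·-removeAt k u v = sum-remove {i = k} (λ c → u c * v c)

    ·-linearʳ : ∀ {N} (u v w : Vector ℤ N) α β → u · (λ c → α * v c - β * w c) ≡ α * (u · v) - β * (u · w)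
    ·-linearʳ {zero}  u v w α β = zero-linear α β
      where
      zero-linear : ∀ α β → + 0 ≡ α * + 0 - β * + 0
      zero-linear = solve-∀
    ·-linearʳ {suc N} u v w α β = begin
      head u * (α * head v - β * head w) + tail u · (λ c → α * tail v c - β * tail w c)
        ≡⟨ cong (λ z → head u * (α * head v - β * head w) + z) (·-linearʳ (tail u) (tail v) (tail w) α β) ⟩
      head u * (α * head v - β * head w) + (α * (tail u · tail v) - β * (tail u · tail w))
        ≡⟨ regroup (head u) (head v) (head w) α β (tail u · tail v) (tail u · tail w) ⟩
      α * (head u * head v + tail u · tail v) - β * (head u * head w + tail u · tail w) ∎
      where
      open ≡-Reasoning
      regroup : ∀ a x y α β s t → a * (α * x - β * y) + (α * s - β * t) ≡ α * (a * x + s) - β * (a * y + t)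
      regroup = solve-∀

    ·-lookup : ∀ {X : Set} (xs : List X) (f g : X → ℕ) →
               (λ c → + f (lookup xs c)) · (λ c → + g (lookup xs c)) ≡ + sum′ (map (λ x → f x ℕ.* g x) xs)
    ·-lookup []       f g = refl
    ·-lookup (x ∷ xs) f g = begin
      + f x * + g x + (λ c → + f (lookup xs c)) · (λ c → + g (lookup xs c))
        ≡⟨ cong₂ _+_ (sym (pos-* (f x) (g x))) (·-lookup xs f g) ⟩
      + (f x ℕ.* g x) + + sum′ (map (λ x → f x ℕ.* g x) xs)
        ≡⟨ pos-+ (f x ℕ.* g x) _ ⟨
      + (f x ℕ.* g x ℕ.+ sum′ (map (λ x → f x ℕ.* g x) xs)) ∎
      where open ≡-Reasoning

  AllPairs-zipWith-All : ∀ {A : Set} {R S : A → A → Set} {Q : A → Set} →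
                         (∀ {u v} → R u v → Q v → S u v) →
                         ∀ {xs} → AllPairs R xs → All Q xs → AllPairs S xs
  AllPairs-zipWith-All f []           []         = []
  AllPairs-zipWith-All f (Rx ∷ Rxs)   (_ ∷ Qxs)  = All.zipWith (λ (r , q) → f r q) (Rx , Qxs) ∷ AllPairs-zipWith-All f Rxs Qxs

  module _ {p : ℕ} (p-prime : Prime p) where

    infix 4 p∣_
    p∣_ : ℤ → Set
    p∣ x = + p ∣ x

    euclidsLemmaℤ : ∀ x y → p∣ x * y → p∣ x ⊎ p∣ y
    euclidsLemmaℤ x y p∣xy with euclidsLemma ℤ.∣ x ∣ ℤ.∣ y ∣ p-prime (subst (p ℕ.∣_) (abs-* x y) (∣⇒∣ᵤ p∣xy))
    ... | inj₁ p∣x = inj₁ (∣ᵤ⇒∣ p∣x)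
    ... | inj₂ p∣y = inj₂ (∣ᵤ⇒∣ p∣y)

    ∣m-n∣n⇒∣m : ∀ {m n} → p∣ m - n → p∣ n → p∣ m
    ∣m-n∣n⇒∣m {m} {n} p∣m-n p∣n = subst p∣_ (m-n+n≡m m n) (∣m∣n⇒∣m+n p∣m-n p∣n)
      where
      m-n+n≡m : ∀ m n → m - n + n ≡ m
      m-n+n≡m = solve-∀

    triangular⇒length≤ : ∀ {X : Set} {N} (r e : X → Vector ℤ N) (xs : List X) →
                         AllPairs (λ u v → p∣ r v · e u) xs → All (λ u → ¬ p∣ r u · e u) xs →
                         length xs ℕ.≤ N
    triangular⇒length≤ r e [] _ _ = z≤n
    triangular⇒length≤ {N = zero}  r e (x ∷ xs) _ (p∤x ∷ _) = contradiction (∣-· (+ p) (r x) (e x) (λ ())) p∤x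
    triangular⇒length≤ {X} {suc N} r e (x ∷ xs) (x◁xs ∷ lower) (p∤x ∷ p∤xs) =
      s≤s (triangular⇒length≤ r′ e′ xs lower′ p∤xs′)
      where
      -- Eliminate the coordinate k, where e x is a unit mod p, from every column.
      pivot : ∃ λ k → ¬ p∣ e x k
      pivot = ¬∀⟶∃¬ (suc N) (λ c → p∣ e x c) (λ c → + p ∣? e x c) (λ p∣ex → p∤x (∣-· (+ p) (r x) (e x) p∣ex))
      k = proj₁ pivot
      α = e x k
      E : X → Vector ℤ (suc N)
      E z c = α * e z c - e z k * e x c
      r′ e′ : X → Vector ℤ N
      r′ y = removeAt (r y) k
      e′ z = removeAt (E z) k
      r′·e′ : ∀ y z → r′ y · e′ z ≡ α * (r y · e z) - e z k * (r y · e x)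
      r′·e′ y z = begin
        r′ y · e′ z                         ≡⟨ +-identityˡ (r′ y · e′ z) ⟨
        + 0 + r′ y · e′ z                   ≡⟨ cong (_+ r′ y · e′ z) (pivot-cancels (r y k) α (e z k)) ⟨
        r y k * E z k + r′ y · e′ z         ≡⟨ ·-removeAt k (r y) (E z) ⟨
        r y · E z                           ≡⟨ ·-linearʳ (r y) (e z) (e x) α (e z k) ⟩
        α * (r y · e z) - e z k * (r y · e x) ∎
        where
        open ≡-Reasoning
        pivot-cancels : ∀ a b c → a * (b * c - c * b) ≡ + 0
        pivot-cancels = solve-∀
      lower′ : AllPairs (λ u v → p∣ r′ v · e′ u) xs
      lower′ = AllPairs-zipWith-All (λ {u} {v} p∣vu p∣vx → subst p∣_ (sym (r′·e′ v u))
                 (∣m∣n⇒∣m-n (∣n⇒∣m*n α p∣vu) (∣n⇒∣m*n (e u k) p∣vx))) lower x◁xs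
      p∤xs′ : All (λ u → ¬ p∣ r′ u · e′ u) xs
      p∤xs′ = All.zipWith (λ {u} (p∣ux , p∤uu) p∣uu′ →
                [ proj₂ pivot , p∤uu ] (euclidsLemmaℤ α (r u · e u)
                  (∣m-n∣n⇒∣m (subst p∣_ (r′·e′ u u) p∣uu′) (∣n⇒∣m*n (e u k) p∣ux))))
                (x◁xs , p∤xs)

open TriangularSystems

open import Data.Nat
open import Data.Nat.Properties
open import Data.Nat.DivMod
open import Data.Nat.Divisibility using (_∣_; ∣m⇒∣m*n; m∣m*n; ∣n⇒∣m*n; m%n≡0⇒n∣m; n∣m⇒m%n≡0; >⇒∤)
open import Data.Nat.Combinatorics using (_C_; nCk+nC[k+1]≡[n+1]C[k+1]; nCk≡n!/k![n-k]!; k![n∸k]!∣n!; k>n⇒nCk≡0; nCn≡1)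
open import Data.Nat.Primality using (Prime; euclidsLemma; prime⇒nonTrivial; ¬prime[0])
open import Data.Nat.ListAction using (sum)
open import Data.Nat.ListAction.Properties using (sum-++)
open import Data.Nat.Tactic.RingSolver using (solve-∀)
open import Data.Bool as Bool using (b≤b)
open import Data.Bool.Properties using (≤-minimum; ≤-maximum; not-¬)
open import Data.Integer as ℤ using (ℤ)
open import Data.Integer.Divisibility.Signed using (∣ᵤ⇒∣; ∣⇒∣ᵤ)
open import Data.Vec using (Vec; []; _∷_; head; tail)
import Data.Vec.Properties as Vec
import Data.Vec.Relation.Unary.All as Vec
open import Data.Vec.Functional using (Vector)
open import Data.Fin.Subset using (Subset; inside; outside; ∁; _─_; ∣_∣)
open import Data.List using (List; []; _∷_; _++_; map; filter; length; lookup; applyUpTo; cartesianProductWith)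
open import Data.List.Properties using (length-++; length-map; length-applyUpTo; map-++; map-∘; map-cong)
open import Data.List.Membership.Propositional using (_∈_)
open import Data.List.Membership.Propositional.Properties using (∈-filter⁻; ∈-++⁻; ∈-map⁻; ∈-applyUpTo⁻)
open import Data.List.Relation.Unary.Any using (here; there)
open import Data.List.Relation.Unary.All as All using (All)
import Data.List.Relation.Unary.All.Properties as All
open import Data.List.Relation.Unary.AllPairs as AllPairs using (AllPairs; []; _∷_)
import Data.List.Relation.Unary.AllPairs.Properties as AllPairs
open import Data.List.Relation.Unary.Unique.Propositional using (Unique)
import Data.List.Relation.Unary.Unique.Propositional.Properties as Unique
open import Data.List.Relation.Binary.Permutation.Propositional using (_↭_; prep; ↭-trans; ↭-refl)
open import Data.List.Relation.Binary.Permutation.Propositional.Properties using (shift; ↭-length; ∈-resp-↭)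
open import Data.Product using (_×_; Σ; _,_; proj₁; proj₂)
open import Data.Product.Properties using (,-injective)
open import Data.Sum using (_⊎_; inj₁; inj₂)
open import Function using (_∘_; case_of_)
open import Level using (0ℓ)
open import Relation.Nullary using (¬_; Dec; contradiction; yes; no)
open import Relation.Binary.Bundles using (Setoid)
open import Relation.Binary.PropositionalEquality
import Relation.Binary.Reasoning.Setoid
open import Defs

C*k!*[n∸k]!≡n! : ∀ {n k} → k ≤ n → (n C k) * (k ! * (n ∸ k) !) ≡ n !
C*k!*[n∸k]!≡n! {n} {k} k≤n = begin
  (n C k) * (k ! * (n ∸ k) !)               ≡⟨ cong (_* (k ! * (n ∸ k) !)) (nCk≡n!/k![n-k]! k≤n) ⟩
  n ! / (k ! * (n ∸ k) !) * (k ! * (n ∸ k) !) ≡⟨ m/n*n≡m (k![n∸k]!∣n! k≤n) ⟩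
  n !                                       ∎
  where
  open ≡-Reasoning
  instance _ = k !* (n ∸ k) !≢0

module _ {p₀ : ℕ} (p-prime : Prime (suc p₀)) where

  private
    p : ℕ
    p = suc p₀

    1<p : 1 < p
    1<p = nonTrivial⇒n>1 p {{prime⇒nonTrivial p-prime}}

  p∤n! : ∀ {n} → n < p → ¬ p ∣ n !
  p∤n! {zero}  _   p∣1  = >⇒∤ 1<p p∣1
  p∤n! {suc n} n<p p∣n! with euclidsLemma (suc n) (n !) p-prime p∣n!
  ... | inj₁ p∣n  = >⇒∤ n<p p∣n
  ... | inj₂ p∣n! = p∤n! (<-trans (n<1+n n) n<p) p∣n!

  p∤nCk : ∀ {n k} → k ≤ n → n < p → ¬ p ∣ n C k
  p∤nCk {n} {k} k≤n n<p p∣C = p∤n! n<p (subst (p ∣_) (C*k!*[n∸k]!≡n! k≤n) (∣m⇒∣m*n (k ! * (n ∸ k) !) p∣C))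

  p∣pCk : ∀ {k} → 0 < k → k < p → p ∣ p C k
  p∣pCk {k} 0<k k<p with euclidsLemma (p C k) (k ! * (p ∸ k) !) p-prime
                          (subst (p ∣_) (sym (C*k!*[n∸k]!≡n! (<⇒≤ k<p))) (m∣m*n (p₀ !)))
  ... | inj₁ p∣C = p∣C
  ... | inj₂ p∣k![p∸k]! with euclidsLemma (k !) ((p ∸ k) !) p-prime p∣k![p∸k]!
  ...   | inj₁ p∣k!     = contradiction p∣k! (p∤n! k<p)
  ...   | inj₂ p∣[p∸k]! = contradiction p∣[p∸k]! (p∤n! (∸-monoʳ-< 0<k (<⇒≤ k<p)))

  -- A record, so that both sides of a congruence can be inferred from its type.
  infix 4 _≈_
  record _≈_ (x y : ℕ) : Set where
    constructor mk≈
    field %≡% : x % p ≡ y % p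
  open _≈_

  ≈-reflexive : ∀ {x y} → x ≡ y → x ≈ y
  ≈-reflexive x≡y = mk≈ (cong (_% p) x≡y)

  ≈-setoid : Setoid 0ℓ 0ℓ
  ≈-setoid = record
    { Carrier       = ℕ
    ; _≈_           = _≈_
    ; isEquivalence = record
      { refl  = mk≈ refl
      ; sym   = λ x≈y → mk≈ (sym (%≡% x≈y))
      ; trans = λ x≈y y≈z → mk≈ (trans (%≡% x≈y) (%≡% y≈z))
      }
    }

  open Setoid ≈-setoid public using () renaming (sym to ≈-sym; trans to ≈-trans)
  module ≈-Reasoning = Relation.Binary.Reasoning.Setoid ≈-setoid

  +-cong-≈ : ∀ {a b c d} → a ≈ b → c ≈ d → a + c ≈ b + d
  +-cong-≈ {a} {b} {c} {d} (mk≈ a≡b) (mk≈ c≡d) = mk≈ (begin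
    (a + c) % p           ≡⟨ %-distribˡ-+ a c p ⟩
    (a % p + c % p) % p   ≡⟨ cong₂ (λ x y → (x + y) % p) a≡b c≡d ⟩
    (b % p + d % p) % p   ≡⟨ %-distribˡ-+ b d p ⟨
    (b + d) % p           ∎)
    where open ≡-Reasoning

  ∣⇒≈0 : ∀ {x} → p ∣ x → x ≈ 0
  ∣⇒≈0 {x} p∣x = mk≈ (n∣m⇒m%n≡0 x p p∣x)

  ≈0⇒∣ : ∀ {x} → x ≈ 0 → p ∣ x
  ≈0⇒∣ {x} (mk≈ x%p≡0) = m%n≡0⇒n∣m x p x%p≡0

  private
    carry : ∀ a b → a + suc b * p ≡ (a + b * p) + p
    carry a b = +-carry a b p
      where
      +-carry : ∀ a b q → a + suc b * q ≡ (a + b * q) + q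
      +-carry = solve-∀

    pascal : ∀ n k → n C k + n C suc k ≡ suc n C suc k
    pascal = nCk+nC[k+1]≡[n+1]C[k+1]

  -- Both congruences compare coefficients in (1 + X)^(n + p) ≡ (1 + X)^n (1 + X^p) mod p.
  [n+p]Ck≈nCk : ∀ n k → k < p → (n + p) C k ≈ n C k
  [n+p]Ck≈nCk zero    zero    _    = ≈-reflexive refl
  [n+p]Ck≈nCk zero    (suc k) k<p  = ∣⇒≈0 (p∣pCk (s≤s z≤n) k<p)
  [n+p]Ck≈nCk (suc n) zero    _    = ≈-reflexive refl
  [n+p]Ck≈nCk (suc n) (suc k) k<p  = begin
    suc (n + p) C suc k              ≡⟨ pascal (n + p) k ⟨
    (n + p) C k + (n + p) C suc k    ≈⟨ +-cong-≈ ([n+p]Ck≈nCk n k (<-trans (n<1+n k) k<p)) ([n+p]Ck≈nCk n (suc k) k<p) ⟩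
    n C k + n C suc k                ≡⟨ pascal n k ⟩
    suc n C suc k                    ∎
    where open ≈-Reasoning

  [n+p]C[k+p]≈nC[k+p]+nCk : ∀ n k → (n + p) C (k + p) ≈ n C (k + p) + n C k
  [n+p]C[k+p]≈nC[k+p]+nCk zero    zero    = ≈-reflexive (nCn≡1 p)
  [n+p]C[k+p]≈nC[k+p]+nCk zero    (suc k) = ≈-reflexive (k>n⇒nCk≡0 (s≤s (m≤n+m p k)))
  [n+p]C[k+p]≈nC[k+p]+nCk (suc n) zero    = begin
    suc (n + p) C p                  ≡⟨ pascal (n + p) p₀ ⟨
    (n + p) C p₀ + (n + p) C p       ≈⟨ +-cong-≈ ([n+p]Ck≈nCk n p₀ (n<1+n p₀)) ([n+p]C[k+p]≈nC[k+p]+nCk n zero) ⟩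
    n C p₀ + (n C p + 1)             ≡⟨ +-assoc (n C p₀) (n C p) 1 ⟨
    n C p₀ + n C p + 1               ≡⟨ cong (_+ 1) (pascal n p₀) ⟩
    suc n C p + 1                    ∎
    where open ≈-Reasoning
  [n+p]C[k+p]≈nC[k+p]+nCk (suc n) (suc k) = begin
    suc (n + p) C suc (k + p)                                 ≡⟨ pascal (n + p) (k + p) ⟨
    (n + p) C (k + p) + (n + p) C (suc k + p)
      ≈⟨ +-cong-≈ ([n+p]C[k+p]≈nC[k+p]+nCk n k) ([n+p]C[k+p]≈nC[k+p]+nCk n (suc k)) ⟩
    (n C (k + p) + n C k) + (n C suc (k + p) + n C suc k)    ≡⟨ interchange (n C (k + p)) (n C k) (n C suc (k + p)) (n C suc k) ⟩
    (n C (k + p) + n C suc (k + p)) + (n C k + n C suc k)    ≡⟨ cong₂ _+_ (pascal n (k + p)) (pascal n k) ⟩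
    suc n C suc (k + p) + suc n C suc k                      ∎
    where
    open ≈-Reasoning
    interchange : ∀ a b c d → (a + b) + (c + d) ≡ (a + c) + (b + d)
    interchange = solve-∀

  lucas-step : ∀ x₀ x₁ s₀ s₁ → x₀ < p → s₀ < p →
               (x₀ + x₁ * p) C (s₀ + s₁ * p) ≈ (x₀ C s₀) * (x₁ C s₁)
  lucas-step x₀ zero s₀ zero _ _ =
    ≈-reflexive (trans (cong₂ _C_ (+-identityʳ x₀) (+-identityʳ s₀)) (sym (*-identityʳ (x₀ C s₀))))
  lucas-step x₀ zero s₀ (suc s₁) x₀<p _ =
    ≈-reflexive (trans (k>n⇒nCk≡0 x₀+0<s) (sym (*-zeroʳ (x₀ C s₀))))
    where
    x₀+0<s : x₀ + 0 < s₀ + suc s₁ * p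
    x₀+0<s = begin-strict
      x₀ + 0             ≡⟨ +-identityʳ x₀ ⟩
      x₀                 <⟨ x₀<p ⟩
      p                  ≤⟨ m≤m+n p (s₁ * p) ⟩
      suc s₁ * p         ≤⟨ m≤n+m (suc s₁ * p) s₀ ⟩
      s₀ + suc s₁ * p    ∎
      where open ≤-Reasoning
  lucas-step x₀ (suc x₁) s₀ zero x₀<p s₀<p = begin
    (x₀ + suc x₁ * p) C (s₀ + 0)       ≡⟨ cong (_C (s₀ + 0)) (carry x₀ x₁) ⟩
    ((x₀ + x₁ * p) + p) C (s₀ + 0)
      ≈⟨ [n+p]Ck≈nCk (x₀ + x₁ * p) (s₀ + 0) (subst (_< p) (sym (+-identityʳ s₀)) s₀<p) ⟩
    (x₀ + x₁ * p) C (s₀ + 0)           ≈⟨ lucas-step x₀ x₁ s₀ zero x₀<p s₀<p ⟩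
    (x₀ C s₀) * 1                      ∎
    where open ≈-Reasoning
  lucas-step x₀ (suc x₁) s₀ (suc s₁) x₀<p s₀<p = begin
    (x₀ + suc x₁ * p) C (s₀ + suc s₁ * p)     ≡⟨ cong₂ _C_ (carry x₀ x₁) (carry s₀ s₁) ⟩
    (X + p) C (S + p)                          ≈⟨ [n+p]C[k+p]≈nC[k+p]+nCk X S ⟩
    X C (S + p) + X C S                        ≡⟨ cong (λ z → X C z + X C S) (carry s₀ s₁) ⟨
    X C (s₀ + suc s₁ * p) + X C S
      ≈⟨ +-cong-≈ (lucas-step x₀ x₁ s₀ (suc s₁) x₀<p s₀<p) (lucas-step x₀ x₁ s₀ s₁ x₀<p s₀<p) ⟩
    (x₀ C s₀) * (x₁ C suc s₁) + (x₀ C s₀) * (x₁ C s₁)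
                                               ≡⟨ *-distribˡ-+ (x₀ C s₀) (x₁ C suc s₁) (x₁ C s₁) ⟨
    (x₀ C s₀) * (x₁ C suc s₁ + x₁ C s₁)
      ≡⟨ cong ((x₀ C s₀) *_) (trans (+-comm (x₁ C suc s₁) (x₁ C s₁)) (pascal x₁ s₁)) ⟩
    (x₀ C s₀) * (suc x₁ C suc s₁)              ∎
    where
    open ≈-Reasoning
    X = x₀ + x₁ * p
    S = s₀ + s₁ * p

  lucas-split : ∀ x s → x C s ≈ ((x % p) C (s % p)) * ((x / p) C (s / p))
  lucas-split x s = begin
    x C s                                          ≡⟨ cong₂ _C_ (m≡m%n+[m/n]*n x p) (m≡m%n+[m/n]*n s p) ⟩
    (x % p + x / p * p) C (s % p + s / p * p)      ≈⟨ lucas-step (x % p) (x / p) (s % p) (s / p) (m%n<n x p) (m%n<n s p) ⟩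
    ((x % p) C (s % p)) * ((x / p) C (s / p))      ∎
    where open ≈-Reasoning

  -- Compare the lowest digits: if that of x is below that of s the Lucas factor vanishes,
  -- otherwise r / p < s / p and the higher digits are handled recursively.
  p∣C-of-small-residue : ∀ k {x r s} .{{_ : NonZero (p ^ k)}} → x % p ^ k ≡ r % p ^ k → r < s → s < p ^ k → p ∣ x C s
  p∣C-of-small-residue zero    _      r<s (s≤s z≤n) = contradiction r<s n≮0
  p∣C-of-small-residue (suc k) {x} {r} {s} x≡r r<s s<p^[1+k] =
    ≈0⇒∣ (≈-trans (lucas-split x s) digit-product≈0)
    where
    instance
      _ = m^n≢0 p k
      _ = m*n≢0 (p ^ k) p
    p^k*p≡p^[1+k] : p ^ k * p ≡ p ^ suc k
    p^k*p≡p^[1+k] = *-comm (p ^ k) p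
    x%p≡r%p : x % p ≡ r % p
    x%p≡r%p = begin
      x % p            ≡⟨ m∣n⇒o%n%m≡o%m p (p ^ suc k) x (m∣m*n (p ^ k)) ⟨
      x % p ^ suc k % p  ≡⟨ cong (_% p) x≡r ⟩
      r % p ^ suc k % p  ≡⟨ m∣n⇒o%n%m≡o%m p (p ^ suc k) r (m∣m*n (p ^ k)) ⟩
      r % p              ∎
      where open ≡-Reasoning
    x/p≡r/p : (x / p) % p ^ k ≡ (r / p) % p ^ k
    x/p≡r/p = begin
      (x / p) % p ^ k        ≡⟨ m%[n*o]/o≡m/o%n x (p ^ k) p ⟨
      x % (p ^ k * p) / p    ≡⟨ cong (_/ p) (trans (%-congʳ p^k*p≡p^[1+k]) (trans x≡r (%-congʳ (sym p^k*p≡p^[1+k])))) ⟩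
      r % (p ^ k * p) / p    ≡⟨ m%[n*o]/o≡m/o%n r (p ^ k) p ⟩
      (r / p) % p ^ k        ∎
      where open ≡-Reasoning
    r/p<s/p : ¬ x % p < s % p → r / p < s / p
    r/p<s/p x%p≮s%p = ≰⇒> λ s/p≤r/p → <⇒≱ r<s (begin
      s                  ≡⟨ m≡m%n+[m/n]*n s p ⟩
      s % p + s / p * p  ≤⟨ +-mono-≤ (subst (s % p ≤_) x%p≡r%p (≮⇒≥ x%p≮s%p)) (*-monoˡ-≤ p s/p≤r/p) ⟩
      r % p + r / p * p  ≡⟨ m≡m%n+[m/n]*n r p ⟨
      r                  ∎)
      where open ≤-Reasoning
    s/p<p^k : s / p < p ^ k
    s/p<p^k = m<n*o⇒m/o<n (subst (s <_) (sym p^k*p≡p^[1+k]) s<p^[1+k])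
    digit-product≈0 : ((x % p) C (s % p)) * ((x / p) C (s / p)) ≈ 0
    digit-product≈0 = case x % p <? s % p of λ where
      (yes x%p<s%p) → ≈-reflexive (cong (_* ((x / p) C (s / p))) (k>n⇒nCk≡0 x%p<s%p))
      (no x%p≮s%p)  → ∣⇒≈0 (∣n⇒∣m*n ((x % p) C (s % p))
                        (p∣C-of-small-residue k x/p≡r/p (r/p<s/p x%p≮s%p) s/p<p^k))

subsets≤ : ∀ m → ℕ → List (Subset m)
subsets≤ zero    s       = [] ∷ []
subsets≤ (suc m) zero    = map (outside ∷_) (subsets≤ m zero)
subsets≤ (suc m) (suc s) = map (outside ∷_) (subsets≤ m (suc s)) ++ map (inside ∷_) (subsets≤ m s)

sumTo-C-zero : ∀ s → sumTo s (0 C_) ≡ 1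
sumTo-C-zero zero    = refl
sumTo-C-zero (suc s) = trans (+-identityʳ _) (sumTo-C-zero s)

sumTo-C-suc : ∀ m s → sumTo (suc s) (suc m C_) ≡ sumTo (suc s) (m C_) + sumTo s (m C_)
sumTo-C-suc m zero = begin
  1 + suc m C 1          ≡⟨ cong (1 +_) (nCk+nC[k+1]≡[n+1]C[k+1] m 0) ⟨
  1 + (1 + m C 1)        ≡⟨ +-comm 1 (1 + m C 1) ⟩
  (1 + m C 1) + 1        ∎
  where open ≡-Reasoning
sumTo-C-suc m (suc s) = begin
  sumTo (suc s) (suc m C_) + suc m C suc (suc s)
    ≡⟨ cong₂ _+_ (sumTo-C-suc m s) (sym (nCk+nC[k+1]≡[n+1]C[k+1] m (suc s))) ⟩
  (sumTo (suc s) (m C_) + sumTo s (m C_)) + (m C suc s + m C suc (suc s))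
    ≡⟨ interchange (sumTo (suc s) (m C_)) (sumTo s (m C_)) (m C suc s) (m C suc (suc s)) ⟩
  (sumTo (suc s) (m C_) + m C suc (suc s)) + (sumTo s (m C_) + m C suc s) ∎
  where
  open ≡-Reasoning
  interchange : ∀ a b c d → (a + b) + (c + d) ≡ (a + d) + (b + c)
  interchange = solve-∀

length-subsets≤ : ∀ m s → length (subsets≤ m s) ≡ sumTo s (m C_)
length-subsets≤ zero    s       = sym (sumTo-C-zero s)
length-subsets≤ (suc m) zero    = trans (length-map _ (subsets≤ m zero)) (length-subsets≤ m zero)
length-subsets≤ (suc m) (suc s) = begin
  length (map (outside ∷_) (subsets≤ m (suc s)) ++ map (inside ∷_) (subsets≤ m s))
    ≡⟨ length-++ (map (outside ∷_) (subsets≤ m (suc s))) ⟩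
  length (map (outside ∷_) (subsets≤ m (suc s))) + length (map (inside ∷_) (subsets≤ m s))
    ≡⟨ cong₂ _+_ (length-map _ (subsets≤ m (suc s))) (length-map _ (subsets≤ m s)) ⟩
  length (subsets≤ m (suc s)) + length (subsets≤ m s)
    ≡⟨ cong₂ _+_ (length-subsets≤ m (suc s)) (length-subsets≤ m s) ⟩
  sumTo (suc s) (m C_) + sumTo s (m C_)
    ≡⟨ sumTo-C-suc m s ⟨
  sumTo (suc s) (suc m C_) ∎
  where open ≡-Reasoning

𝟙[_⊆_] : ∀ {m} → Subset m → Subset m → ℕ
𝟙[ []          ⊆ []          ] = 1
𝟙[ outside ∷ T ⊆ _ ∷ S       ] = 𝟙[ T ⊆ S ]
𝟙[ inside ∷ T  ⊆ inside ∷ S  ] = 𝟙[ T ⊆ S ]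
𝟙[ inside ∷ T  ⊆ outside ∷ S ] = 0

𝟙[⊆─] : ∀ {m} (T B A : Subset m) → 𝟙[ T ⊆ B ─ A ] ≡ 𝟙[ T ⊆ ∁ A ] * 𝟙[ T ⊆ B ]
𝟙[⊆─] []            []            []            = refl
𝟙[⊆─] (outside ∷ T) (_ ∷ B)       (_ ∷ A)       = 𝟙[⊆─] T B A
𝟙[⊆─] (inside ∷ T)  (inside ∷ B)  (outside ∷ A) = 𝟙[⊆─] T B A
𝟙[⊆─] (inside ∷ T)  (outside ∷ B) (outside ∷ A) = sym (*-zeroʳ 𝟙[ T ⊆ ∁ A ])
𝟙[⊆─] (inside ∷ T)  (_ ∷ B)       (inside ∷ A)  = refl

sum-map-zero : ∀ {X : Set} (xs : List X) → sum (map (λ _ → 0) xs) ≡ 0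
sum-map-zero []       = refl
sum-map-zero (_ ∷ xs) = sum-map-zero xs

sum-map-∘ : ∀ {X Y : Set} (f : Y → ℕ) (g : X → Y) xs → sum (map f (map g xs)) ≡ sum (map (f ∘ g) xs)
sum-map-∘ f g xs = cong sum (sym (map-∘ xs))

module _ (d : ℕ) where

  vandermonde : ∀ m s (S : Subset m) →
                sum (map (λ T → 𝟙[ T ⊆ S ] * (d C (s ∸ ∣ T ∣))) (subsets≤ m s)) ≡ (∣ S ∣ + d) C s
  vandermonde zero    s       []       = trans (+-identityʳ _) (*-identityˡ (d C s))
  vandermonde (suc m) zero    (_ ∷ S)  = trans (sum-map-∘ _ (outside ∷_) (subsets≤ m zero)) (vandermonde m zero S)
  vandermonde (suc m) (suc s) (x ∷ S)  = begin
    sum (map term (map (outside ∷_) (subsets≤ m (suc s)) ++ map (inside ∷_) (subsets≤ m s)))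
      ≡⟨ cong sum (map-++ term (map (outside ∷_) (subsets≤ m (suc s))) _) ⟩
    sum (map term (map (outside ∷_) (subsets≤ m (suc s))) ++ map term (map (inside ∷_) (subsets≤ m s)))
      ≡⟨ sum-++ (map term (map (outside ∷_) (subsets≤ m (suc s)))) _ ⟩
    sum (map term (map (outside ∷_) (subsets≤ m (suc s)))) + sum (map term (map (inside ∷_) (subsets≤ m s)))
      ≡⟨ cong₂ _+_ (trans (sum-map-∘ term (outside ∷_) (subsets≤ m (suc s))) (vandermonde m (suc s) S))
                   (sum-map-∘ term (inside ∷_) (subsets≤ m s)) ⟩
    (∣ S ∣ + d) C suc s + sum (map (term ∘ (inside ∷_)) (subsets≤ m s))
      ≡⟨ step x ⟩
    (∣ x ∷ S ∣ + d) C suc s ∎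
    where
    open ≡-Reasoning
    term : Subset (suc m) → ℕ
    term T = 𝟙[ T ⊆ x ∷ S ] * (d C (suc s ∸ ∣ T ∣))
    step : ∀ x → (∣ S ∣ + d) C suc s + sum (map (λ T → 𝟙[ inside ∷ T ⊆ x ∷ S ] * (d C (s ∸ ∣ T ∣))) (subsets≤ m s))
                 ≡ (∣ x ∷ S ∣ + d) C suc s
    step inside  = trans (cong ((∣ S ∣ + d) C suc s +_) (vandermonde m s S))
                         (trans (+-comm ((∣ S ∣ + d) C suc s) ((∣ S ∣ + d) C s)) (nCk+nC[k+1]≡[n+1]C[k+1] (∣ S ∣ + d) s))
    step outside = trans (cong ((∣ S ∣ + d) C suc s +_) (sum-map-zero (subsets≤ m s))) (+-identityʳ _)

≡[mod]⇒%≡ : ∀ {x y} q .{{_ : NonZero q}} → x ≡ y [mod q ] → x % q ≡ y % q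
≡[mod]⇒%≡ {x} {y} q (i , j , x+iq≡y+jq) = begin
  x % q              ≡⟨ [m+kn]%n≡m%n x i q ⟨
  (x + i * q) % q    ≡⟨ cong (_% q) x+iq≡y+jq ⟩
  (y + j * q) % q    ≡⟨ [m+kn]%n≡m%n y j q ⟩
  y % q              ∎
  where open ≡-Reasoning

[y+[q∸a]]%q≡[ℓ∸a]%q : ∀ {y ℓ a} q .{{_ : NonZero q}} → y % q ≡ ℓ % q → a ≤ ℓ → a ≤ q →
                       (y + (q ∸ a)) % q ≡ (ℓ ∸ a) % q
[y+[q∸a]]%q≡[ℓ∸a]%q {y} {ℓ} {a} q y≡ℓ a≤ℓ a≤q = begin
  (y + (q ∸ a)) % q                ≡⟨ %-distribˡ-+ y (q ∸ a) q ⟩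
  (y % q + (q ∸ a) % q) % q        ≡⟨ cong (λ z → (z + (q ∸ a) % q) % q) y≡ℓ ⟩
  (ℓ % q + (q ∸ a) % q) % q        ≡⟨ %-distribˡ-+ ℓ (q ∸ a) q ⟨
  (ℓ + (q ∸ a)) % q                ≡⟨ cong (_% q) ℓ+[q∸a]≡ℓ∸a+q ⟩
  ((ℓ ∸ a) + q) % q                ≡⟨ [m+n]%n≡m%n (ℓ ∸ a) q ⟩
  (ℓ ∸ a) % q                      ∎
  where
  open ≡-Reasoning
  ℓ+[q∸a]≡ℓ∸a+q : ℓ + (q ∸ a) ≡ (ℓ ∸ a) + q
  ℓ+[q∸a]≡ℓ∸a+q = begin
    ℓ + (q ∸ a)            ≡⟨ cong (_+ (q ∸ a)) (m∸n+n≡m a≤ℓ) ⟨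
    (ℓ ∸ a) + a + (q ∸ a)  ≡⟨ +-assoc (ℓ ∸ a) a (q ∸ a) ⟩
    (ℓ ∸ a) + (a + (q ∸ a)) ≡⟨ cong ((ℓ ∸ a) +_) (m+[n∸m]≡n a≤q) ⟩
    (ℓ ∸ a) + q            ∎

AllPairs-tabulate : ∀ {A : Set} {R : A → A → Set} {xs : List A} →
                    (∀ {u v} → u ∈ xs → v ∈ xs → R u v) → AllPairs R xs
AllPairs-tabulate {xs = []}     _ = []
AllPairs-tabulate {xs = x ∷ xs} R-∈ =
  All.tabulate (λ v∈xs → R-∈ (here refl) (there v∈xs)) ∷ AllPairs-tabulate (λ u∈xs v∈xs → R-∈ (there u∈xs) (there v∈xs))

∣A─A∣≡0 : ∀ {m} (A : Subset m) → ∣ A ─ A ∣ ≡ 0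
∣A─A∣≡0 []            = refl
∣A─A∣≡0 (outside ∷ A) = ∣A─A∣≡0 A
∣A─A∣≡0 (inside ∷ A)  = ∣A─A∣≡0 A

∣─∣-tail : ∀ {m} (u v : Subset (suc m)) → head u Bool.≤ head v → ∣ u ─ v ∣ ≡ ∣ tail u ─ tail v ∣
∣─∣-tail (outside ∷ u) (outside ∷ v) _   = refl
∣─∣-tail (outside ∷ u) (inside ∷ v)  _   = refl
∣─∣-tail (inside ∷ u)  (inside ∷ v) b≤b = refl

-- Listing the sets avoiding the first point first is what makes the matrix below triangular.
module _ {m : ℕ} where

  private
    outside? inside? : (A : Subset (suc m)) → Dec (head A ≡ _)
    outside? A = head A Bool.≟ outside
    inside?  A = head A Bool.≟ inside

    avoiding containing : List (Subset (suc m)) → List (Subset (suc m))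
    avoiding   = filter outside?
    containing = filter inside?

  sortByHead : List (Subset (suc m)) → List (Subset (suc m))
  sortByHead F = avoiding F ++ containing F

  sortByHead-↭ : ∀ F → sortByHead F ↭ F
  sortByHead-↭ []                  = ↭-refl
  sortByHead-↭ ((outside ∷ A) ∷ F) = prep _ (sortByHead-↭ F)
  sortByHead-↭ ((inside ∷ A) ∷ F)  = ↭-trans (shift (inside ∷ A) (avoiding F) (containing F)) (prep _ (sortByHead-↭ F))

  sortByHead-unique : ∀ {F} → Unique F → Unique (sortByHead F)
  sortByHead-unique {F} F-unique = Unique.++⁺ (Unique.filter⁺ outside? F-unique) (Unique.filter⁺ inside? F-unique)
    λ (v∈avoiding , v∈containing) →
      not-¬ (proj₂ (∈-filter⁻ outside? {xs = F} v∈avoiding)) (proj₂ (∈-filter⁻ inside? {xs = F} v∈containing))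

  sortByHead-sorted : ∀ F → AllPairs (λ u v → head u Bool.≤ head v) (sortByHead F)
  sortByHead-sorted F = AllPairs.++⁺
    (AllPairs-tabulate λ {u} {v} u∈ _ → ordered {u} {v} (inj₁ (outside-head u∈)))
    (AllPairs-tabulate λ {u} {v} _ v∈ → ordered {u} {v} (inj₂ (inside-head v∈)))
    (All.tabulate λ {u} u∈ → All.tabulate λ {v} _ → ordered {u} {v} (inj₁ (outside-head u∈)))
    where
    outside-head : ∀ {u} → u ∈ avoiding F → head u ≡ outside
    outside-head u∈ = proj₂ (∈-filter⁻ outside? {xs = F} u∈)
    inside-head : ∀ {v} → v ∈ containing F → head v ≡ inside
    inside-head v∈ = proj₂ (∈-filter⁻ inside? {xs = F} v∈)
    ordered : ∀ {u v : Subset (suc m)} → head u ≡ outside ⊎ head v ≡ inside → head u Bool.≤ head v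
    ordered {v = v} (inj₁ hu≡outside) rewrite hu≡outside = ≤-minimum (head v)
    ordered {u = u} (inj₂ hv≡inside)  rewrite hv≡inside  = ≤-maximum (head u)

-- The pair (d, s) becomes the interval L = {q ∸ d, …, q ∸ d + s ∸ 1}, so q ∸ min L = d and |L| = s.
toInterval : ℕ → ℕ × ℕ → ℕ × ℕ
toInterval q (d , s) = q ∸ d , (q ∸ d) + (s ∸ 1)

toInterval-injective : ∀ {q d s e t} → d ≤ q → e ≤ q → 1 ≤ s → 1 ≤ t →
                       toInterval q (d , s) ≡ toInterval q (e , t) → (d , s) ≡ (e , t)
toInterval-injective {q} {d} {s} {e} {t} d≤q e≤q 1≤s 1≤t eq with ∸-cancelˡ-≡ d≤q e≤q (cong proj₁ eq)
... | refl = cong (d ,_) (begin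
  s             ≡⟨ m∸n+n≡m 1≤s ⟨
  s ∸ 1 + 1     ≡⟨ cong (_+ 1) (+-cancelˡ-≡ (q ∸ d) (s ∸ 1) (t ∸ 1) (cong proj₂ eq)) ⟩
  t ∸ 1 + 1     ≡⟨ m∸n+n≡m 1≤t ⟩
  t             ∎)
  where open ≡-Reasoning

toInterval-valid : ∀ {q d s} → 1 ≤ s → s ≤ d → d < q → ValidInterval q (toInterval q (d , s))
toInterval-valid {q} {d} {s} 1≤s s≤d d<q = m<n⇒0<n∸m d<q , m≤m+n (q ∸ d) (s ∸ 1) , (begin
  (q ∸ d) + (s ∸ 1)   ≤⟨ +-monoʳ-≤ (q ∸ d) (∸-monoˡ-≤ 1 s≤d) ⟩
  (q ∸ d) + (d ∸ 1)   ≡⟨ +-∸-assoc (q ∸ d) (≤-trans 1≤s s≤d) ⟨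
  (q ∸ d) + d ∸ 1     ≡⟨ cong (_∸ 1) (m∸n+n≡m (<⇒≤ d<q)) ⟩
  q ∸ 1               ∎)
  where open ≤-Reasoning

toInterval-recovers : ∀ {q d s} → d ≤ q → 1 ≤ s →
                      let (a , b) = toInterval q (d , s) in q ∸ a ≡ d × suc (b ∸ a) ≡ s
toInterval-recovers {q} {d} {s} d≤q 1≤s =
  m∸[m∸n]≡n d≤q , trans (cong suc (m+n∸m≡n (q ∸ d) (s ∸ 1))) (trans (+-comm 1 (s ∸ 1)) (m∸n+n≡m 1≤s))

module _ {p₀ : ℕ} (p-prime : Prime (suc p₀)) (k : ℕ) where

  private
    p q : ℕ
    p = suc p₀
    q = p ^ k
    instance
      q≢0 : NonZero q
      q≢0 = m^n≢0 p k

  goodInterval-criterion : ∀ m {a b} → 1 ≤ a → a ≤ b → b ≤ q ∸ 1 → ¬ p ∣ (q ∸ a) C suc (b ∸ a) →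
                           GoodInterval (suc m) q a b
  goodInterval-criterion m {a} {b} 1≤a a≤b b≤q∸1 p∤C F F-unique F-sperner = let open ≤-Reasoning in begin
    length F               ≡⟨ ↭-length (sortByHead-↭ F) ⟨
    length (sortByHead F)  ≤⟨ triangular⇒length≤ p-prime row col (sortByHead F) lower diagonal ⟩
    length Ts              ≡⟨ length-subsets≤ m s ⟩
    sumTo s (m C_)         ∎
    where
    d s : ℕ
    d = q ∸ a
    s = suc (b ∸ a)
    Ts = subsets≤ m s
    weight : Subset m → ℕ
    weight T = d C (s ∸ ∣ T ∣)
    row col : Subset (suc m) → Vector ℤ (length Ts)
    row A c = ℤ.+ 𝟙[ lookup Ts c ⊆ ∁ (tail A) ]
    col B c = ℤ.+ (𝟙[ lookup Ts c ⊆ tail B ] * weight (lookup Ts c))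

    row·col : ∀ A B → row A · col B ≡ ℤ.+ ((∣ tail B ─ tail A ∣ + d) C s)
    row·col A B = begin
      row A · col B
        ≡⟨ ·-lookup Ts (λ T → 𝟙[ T ⊆ ∁ (tail A) ]) (λ T → 𝟙[ T ⊆ tail B ] * weight T) ⟩
      ℤ.+ sum (map (λ T → 𝟙[ T ⊆ ∁ (tail A) ] * (𝟙[ T ⊆ tail B ] * weight T)) Ts)
        ≡⟨ cong (λ ts → ℤ.+ sum ts) (map-cong (λ T → trans (sym (*-assoc 𝟙[ T ⊆ ∁ (tail A) ] 𝟙[ T ⊆ tail B ] (weight T)))
                                              (cong (_* weight T) (sym (𝟙[⊆─] T (tail B) (tail A))))) Ts) ⟩
      ℤ.+ sum (map (λ T → 𝟙[ T ⊆ tail B ─ tail A ] * weight T) Ts)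
        ≡⟨ cong ℤ.+_ (vandermonde d m s (tail B ─ tail A)) ⟩
      ℤ.+ ((∣ tail B ─ tail A ∣ + d) C s) ∎
      where open ≡-Reasoning

    s<q : s < q
    s<q = begin-strict
      suc (b ∸ a)   ≡⟨ +-∸-assoc 1 a≤b ⟨
      suc b ∸ a     ≤⟨ ∸-monoʳ-≤ (suc b) 1≤a ⟩
      b             <⟨ m≤pred[n]⇒suc[m]≤n b≤q∸1 ⟩
      q             ∎
      where open ≤-Reasoning

    lower : AllPairs (λ u v → p∣_ p-prime (row v · col u)) (sortByHead F)
    lower = AllPairs.zipWith separated (AllPairs.zip (sortByHead-unique F-unique , sortByHead-sorted F) , members)
      where
      members : AllPairs (λ u v → u ∈ F × v ∈ F) (sortByHead F)
      members = AllPairs-tabulate λ u∈ v∈ → ∈-resp-↭ (sortByHead-↭ F) u∈ , ∈-resp-↭ (sortByHead-↭ F) v∈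
      separated : ∀ {u v} → (u ≢ v × head u Bool.≤ head v) × (u ∈ F × v ∈ F) → p∣_ p-prime (row v · col u)
      separated {u} {v} ((u≢v , hu≤hv) , u∈F , v∈F) with F-sperner u∈F v∈F u≢v
      ... | ℓ , (a≤ℓ , ℓ≤b) , ∣u─v∣≡ℓ = subst (p∣_ p-prime) (sym (row·col v u)) (∣ᵤ⇒∣ p∣C)
        where
        residue : (∣ tail u ─ tail v ∣ + d) % q ≡ (ℓ ∸ a) % q
        residue = [y+[q∸a]]%q≡[ℓ∸a]%q {y = ∣ tail u ─ tail v ∣} q
                    (subst (λ z → z % q ≡ ℓ % q) (∣─∣-tail u v hu≤hv) (≡[mod]⇒%≡ {x = ∣ u ─ v ∣} q ∣u─v∣≡ℓ))
                    a≤ℓ (≤-trans a≤b (≤-trans b≤q∸1 (m∸n≤m q 1)))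
        p∣C : p ∣ (∣ tail u ─ tail v ∣ + d) C s
        p∣C = p∣C-of-small-residue p-prime k {x = ∣ tail u ─ tail v ∣ + d} residue (s≤s (∸-monoˡ-≤ a ℓ≤b)) s<q

    diagonal : All (λ u → ¬ p∣_ p-prime (row u · col u)) (sortByHead F)
    diagonal = All.universal (λ u p∣uu → p∤C (subst (λ z → p ∣ (z + d) C s) (∣A─A∣≡0 (tail u))
                                               (∣⇒∣ᵤ (subst (p∣_ p-prime) (row·col u u) p∣uu)))) _

  toInterval-good : ∀ m {d s} → 1 ≤ s → s ≤ d → d < q → ¬ p ∣ d C s →
                    let (a , b) = toInterval q (d , s) in ValidInterval q (a , b) × GoodInterval (suc m) q a b
  toInterval-good m 1≤s s≤d d<q p∤dCs =
    let valid@(1≤a , a≤b , b≤q∸1) = toInterval-valid 1≤s s≤d d<q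
        q∸a≡d , size≡s            = toInterval-recovers (<⇒≤ d<q) 1≤s
    in valid , goodInterval-criterion m 1≤a a≤b b≤q∸1 (subst₂ (λ x y → ¬ p ∣ x C y) (sym q∸a≡d) (sym size≡s) p∤dCs)

length-cartesianProductWith : ∀ {A B C : Set} (f : A → B → C) xs ys →
                              length (cartesianProductWith f xs ys) ≡ length xs * length ys
length-cartesianProductWith f []       ys = refl
length-cartesianProductWith f (x ∷ xs) ys = begin
  length (map (f x) ys ++ cartesianProductWith f xs ys)          ≡⟨ length-++ (map (f x) ys) ⟩
  length (map (f x) ys) + length (cartesianProductWith f xs ys)
    ≡⟨ cong₂ _+_ (length-map (f x) ys) (length-cartesianProductWith f xs ys) ⟩
  length ys + length xs * length ys                              ∎
  where open ≡-Reasoning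

Unique-map⁺ : ∀ {A B : Set} {f : A → B} {xs} → (∀ {x y} → x ∈ xs → y ∈ xs → f x ≡ f y → x ≡ y) →
              Unique xs → Unique (map f xs)
Unique-map⁺ f-injective xs-unique = AllPairs.map⁺ (AllPairs.zipWith
  (λ (x≢y , x∈ , y∈) fx≡fy → x≢y (f-injective x∈ y∈ fx≡fy))
  (xs-unique , AllPairs-tabulate (λ x∈ y∈ → x∈ , y∈)))

*-^ : ∀ a b k → (a * b) ^ k ≡ a ^ k * b ^ k
*-^ a b zero    = refl
*-^ a b (suc k) = trans (cong ((a * b) *_) (*-^ a b k)) (interchange a b (a ^ k) (b ^ k))
  where
  interchange : ∀ a b x y → (a * b) * (x * y) ≡ (a * x) * (b * y)
  interchange = solve-∀

digit-injective : ∀ {a b x y} n .{{_ : NonZero n}} → a < n → b < n → a + x * n ≡ b + y * n → a ≡ b × x ≡ y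
digit-injective {a} {b} {x} {y} n a<n b<n eq = a≡b , *-cancelʳ-≡ x y n (+-cancelˡ-≡ a _ _ (trans eq (cong (_+ y * n) (sym a≡b))))
  where
  a≡b : a ≡ b
  a≡b = begin
    a                ≡⟨ m<n⇒m%n≡m a<n ⟨
    a % n            ≡⟨ [m+kn]%n≡m%n a x n ⟨
    (a + x * n) % n  ≡⟨ cong (_% n) eq ⟩
    (b + y * n) % n  ≡⟨ [m+kn]%n≡m%n b y n ⟩
    b % n            ≡⟨ m<n⇒m%n≡m b<n ⟩
    b                ∎
    where open ≡-Reasoning

digitPairs : ℕ → List (ℕ × ℕ)
digitPairs zero    = []
digitPairs (suc n) = digitPairs n ++ map (n ,_) (applyUpTo suc n)

∈-digitPairs⁻ : ∀ n {x} → x ∈ digitPairs n → 1 ≤ proj₂ x × proj₂ x ≤ proj₁ x × proj₁ x < n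
∈-digitPairs⁻ (suc n) x∈ with ∈-++⁻ (digitPairs n) x∈
... | inj₁ x∈ds = let 1≤s , s≤d , d<n = ∈-digitPairs⁻ n x∈ds in 1≤s , s≤d , m<n⇒m<1+n d<n
... | inj₂ x∈new with ∈-map⁻ (n ,_) x∈new
...   | s , s∈ , refl with ∈-applyUpTo⁻ suc s∈
...     | i , i<n , refl = s≤s z≤n , i<n , n<1+n n

digitPairs-unique : ∀ n → Unique (digitPairs n)
digitPairs-unique zero    = []
digitPairs-unique (suc n) = Unique.++⁺ (digitPairs-unique n)
  (Unique.map⁺ (λ eq → proj₂ (,-injective eq)) (Unique.applyUpTo⁺₁ suc n (λ i<j _ → <⇒≢ (s≤s i<j))))
  λ (x∈old , x∈new) → <-irrefl (new-top x∈new) (proj₂ (proj₂ (∈-digitPairs⁻ n x∈old)))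
  where
  new-top : ∀ {x} → x ∈ map (n ,_) (applyUpTo suc n) → proj₁ x ≡ n
  new-top x∈ with ∈-map⁻ (n ,_) x∈
  ... | _ , _ , refl = refl

length-digitPairs : ∀ n → 2 * length (digitPairs (suc n)) ≡ suc n * n
length-digitPairs zero    = refl
length-digitPairs (suc n) = begin
  2 * length (digitPairs (suc n) ++ map (suc n ,_) (applyUpTo suc (suc n)))
    ≡⟨ cong (2 *_) (length-++ (digitPairs (suc n))) ⟩
  2 * (length (digitPairs (suc n)) + length (map (suc n ,_) (applyUpTo suc (suc n))))
    ≡⟨ cong (λ z → 2 * (length (digitPairs (suc n)) + z))
            (trans (length-map _ (applyUpTo suc (suc n))) (length-applyUpTo suc (suc n))) ⟩
  2 * (length (digitPairs (suc n)) + suc n)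
    ≡⟨ *-distribˡ-+ 2 (length (digitPairs (suc n))) (suc n) ⟩
  2 * length (digitPairs (suc n)) + 2 * suc n
    ≡⟨ cong (_+ 2 * suc n) (length-digitPairs n) ⟩
  suc n * n + 2 * suc n
    ≡⟨ triangle n ⟩
  suc (suc n) * suc n ∎
  where
  open ≡-Reasoning
  triangle : ∀ n → suc n * n + 2 * suc n ≡ suc (suc n) * suc n
  triangle = solve-∀

module _ {p₀ : ℕ} (p-prime : Prime (suc p₀)) where

  private
    p : ℕ
    p = suc p₀

  DigitPair : ℕ × ℕ → Set
  DigitPair (d , s) = 1 ≤ s × s ≤ d × d < p

  digitStrings : ∀ k → List (Vec (ℕ × ℕ) k)
  digitStrings zero    = [] ∷ []
  digitStrings (suc k) = cartesianProductWith _∷_ (digitPairs p) (digitStrings k)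

  digitStrings-unique : ∀ k → Unique (digitStrings k)
  digitStrings-unique zero    = All.[] ∷ []
  digitStrings-unique (suc k) =
    Unique.cartesianProductWith⁺ _∷_ Vec.∷-injective (digitPairs-unique p) (digitStrings-unique k)

  digitStrings-valid : ∀ k → All (Vec.All DigitPair) (digitStrings k)
  digitStrings-valid zero    = Vec.[] All.∷ All.[]
  digitStrings-valid (suc k) = All.cartesianProductWith⁺ (setoid _) (setoid _) _∷_ (digitPairs p) (digitStrings k)
    (λ x∈ ds∈ → ∈-digitPairs⁻ p x∈ Vec.∷ All.lookup (digitStrings-valid k) ds∈)

  2^k*length-digitStrings : ∀ k → 2 ^ k * length (digitStrings k) ≡ (p * p₀) ^ k
  2^k*length-digitStrings zero    = refl
  2^k*length-digitStrings (suc k) = begin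
    2 ^ suc k * length (cartesianProductWith _∷_ (digitPairs p) (digitStrings k))
      ≡⟨ cong (2 ^ suc k *_) (length-cartesianProductWith _∷_ (digitPairs p) (digitStrings k)) ⟩
    (2 * 2 ^ k) * (E * length (digitStrings k))
      ≡⟨ interchange 2 (2 ^ k) E (length (digitStrings k)) ⟩
    (2 * E) * (2 ^ k * length (digitStrings k))
      ≡⟨ cong₂ _*_ (length-digitPairs p₀) (2^k*length-digitStrings k) ⟩
    (p * p₀) * (p * p₀) ^ k ∎
    where
    open ≡-Reasoning
    E = length (digitPairs p)
    interchange : ∀ a b c d → (a * b) * (c * d) ≡ (a * c) * (b * d)
    interchange = solve-∀

  -- Reads a string of digit pairs in base p, least significant digit first.
  value : ∀ {k} → Vec (ℕ × ℕ) k → ℕ × ℕ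
  value []             = 0 , 0
  value ((d , s) ∷ ds) = d + proj₁ (value ds) * p , s + proj₂ (value ds) * p

  value-top< : ∀ {k} {ds : Vec (ℕ × ℕ) k} → Vec.All DigitPair ds → proj₁ (value ds) < p ^ k
  value-top< {ds = []}           Vec.[]                     = s≤s z≤n
  value-top< {suc k} {(d , s) ∷ ds} ((_ , _ , d<p) Vec.∷ valid) = begin-strict
    d + D * p        <⟨ +-monoˡ-< (D * p) d<p ⟩
    p + D * p        ≤⟨ *-monoˡ-≤ p (value-top< valid) ⟩
    p ^ k * p        ≡⟨ *-comm (p ^ k) p ⟩
    p * p ^ k        ∎
    where
    open ≤-Reasoning
    D = proj₁ (value ds)

  value-bottom≤top : ∀ {k} {ds : Vec (ℕ × ℕ) k} → Vec.All DigitPair ds → proj₂ (value ds) ≤ proj₁ (value ds)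
  value-bottom≤top Vec.[]                      = z≤n
  value-bottom≤top ((_ , s≤d , _) Vec.∷ valid) = +-mono-≤ s≤d (*-monoˡ-≤ p (value-bottom≤top valid))

  value-∤C : ∀ {k} {ds : Vec (ℕ × ℕ) k} → Vec.All DigitPair ds → ¬ p ∣ proj₁ (value ds) C proj₂ (value ds)
  value-∤C {ds = []}           Vec.[]                         = p∤nCk p-prime z≤n (s≤s z≤n)
  value-∤C {ds = (d , s) ∷ ds} ((_ , s≤d , d<p) Vec.∷ valid) p∣C
    with euclidsLemma (d C s) (proj₁ (value ds) C proj₂ (value ds)) p-prime
           (≈0⇒∣ p-prime (≈-trans p-prime (≈-sym p-prime digit-split) (∣⇒≈0 p-prime p∣C)))
    where digit-split = lucas-step p-prime d (proj₁ (value ds)) s (proj₂ (value ds)) d<p (≤-<-trans s≤d d<p)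
  ... | inj₁ p∣dCs = p∤nCk p-prime s≤d d<p p∣dCs
  ... | inj₂ p∣C′  = value-∤C valid p∣C′

  value-injective : ∀ {k} {ds es : Vec (ℕ × ℕ) k} → Vec.All DigitPair ds → Vec.All DigitPair es →
                    value ds ≡ value es → ds ≡ es
  value-injective Vec.[] Vec.[] _ = refl
  value-injective {ds = (d , s) ∷ ds} {(e , t) ∷ es} ((_ , s≤d , d<p) Vec.∷ valid-ds) ((_ , t≤e , e<p) Vec.∷ valid-es) eq
    with digit-injective p d<p e<p (cong proj₁ eq) | digit-injective p (≤-<-trans s≤d d<p) (≤-<-trans t≤e e<p) (cong proj₂ eq)
  ... | refl , D≡E | refl , S≡T = cong ((d , s) ∷_) (value-injective valid-ds valid-es (cong₂ _,_ D≡E S≡T))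

  value-bottom-positive : ∀ {k} {ds : Vec (ℕ × ℕ) (suc k)} → Vec.All DigitPair ds → 1 ≤ proj₂ (value ds)
  value-bottom-positive {ds = (d , s) ∷ ds} ((1≤s , _) Vec.∷ _) = ≤-trans 1≤s (m≤m+n s (proj₂ (value ds) * p))

module _ {p₀ : ℕ} (p-prime : Prime (suc p₀)) (k : ℕ) where

  private
    p q : ℕ
    p = suc p₀
    q = p ^ suc k

  lucasIntervals : List (ℕ × ℕ)
  lucasIntervals = map (toInterval q ∘ value p-prime) (digitStrings p-prime (suc k))

  lucasIntervals-unique : Unique lucasIntervals
  lucasIntervals-unique = Unique-map⁺ injective (digitStrings-unique p-prime (suc k))
    where
    injective : ∀ {ds es} → ds ∈ digitStrings p-prime (suc k) → es ∈ digitStrings p-prime (suc k) →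
                toInterval q (value p-prime ds) ≡ toInterval q (value p-prime es) → ds ≡ es
    injective ds∈ es∈ eq = value-injective p-prime valid-ds valid-es
      (toInterval-injective (<⇒≤ (value-top< p-prime valid-ds)) (<⇒≤ (value-top< p-prime valid-es))
                            (value-bottom-positive p-prime valid-ds) (value-bottom-positive p-prime valid-es) eq)
      where
      valid-ds = All.lookup (digitStrings-valid p-prime (suc k)) ds∈
      valid-es = All.lookup (digitStrings-valid p-prime (suc k)) es∈

  lucasIntervals-good : ∀ m → All (λ ab → ValidInterval q ab × GoodInterval (suc m) q (proj₁ ab) (proj₂ ab)) lucasIntervals
  lucasIntervals-good m = All.map⁺ (All.map (λ valid →
    toInterval-good p-prime (suc k) m (value-bottom-positive p-prime valid) (value-bottom≤top p-prime valid)
                                      (value-top< p-prime valid) (value-∤C p-prime valid))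
    (digitStrings-valid p-prime (suc k)))

  lucasIntervals-count : q * p₀ ^ suc k ≤ 2 ^ suc k * (length lucasIntervals + q)
  lucasIntervals-count = begin
    q * p₀ ^ suc k                                  ≡⟨ *-^ p p₀ (suc k) ⟨
    (p * p₀) ^ suc k                                ≡⟨ 2^k*length-digitStrings p-prime (suc k) ⟨
    2 ^ suc k * length (digitStrings p-prime (suc k)) ≡⟨ cong (2 ^ suc k *_) (length-map _ (digitStrings p-prime (suc k))) ⟨
    2 ^ suc k * length lucasIntervals               ≤⟨ *-monoʳ-≤ (2 ^ suc k) (m≤m+n (length lucasIntervals) q) ⟩
    2 ^ suc k * (length lucasIntervals + q)         ∎
    where open ≤-Reasoning

theorem4p3 : (n p k : ℕ) → 1 ≤ n → Prime p → 2 ≤ k →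
    Σ (List (ℕ × ℕ)) λ Ls →
    Unique Ls ×
    All (λ ab → ValidInterval (p ^ k) ab × GoodInterval n (p ^ k) (proj₁ ab) (proj₂ ab)) Ls ×
    p ^ k * (p ∸ 1) ^ k ≤ 2 ^ k * (length Ls + p ^ k)
theorem4p3 zero    _        _       ()  _       _
theorem4p3 _       zero     _       _   p-prime _  = contradiction p-prime ¬prime[0]
theorem4p3 _       (suc _)  zero    _   _       ()
theorem4p3 (suc m) (suc p₀) (suc k) _   p-prime _  =
  lucasIntervals p-prime k , lucasIntervals-unique p-prime k , lucasIntervals-good p-prime k m , lucasIntervals-count p-prime k
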